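{- Let $f(n)=an^{2}+bn+c$ with $a,b,c\in\mathbb{Z}$, $a\neq 0$ even and $b$ odd. Then the 2-adic valuation tree of $f$ has exactly one infinite branch. Furthermore, the valuation of the terminating node at level $i$ (for each $i\geq 1$) is $i-1$.
   Context: $\nu_2(x)$ denotes the 2-adic valuation of an integer $x$ (with $\nu_2(0)=+\infty$), $\mathbb{N}=\{0,1,2,\ldots\}$. The 2-adic valuation tree of $f$: a node at level $i\geq 0$ is a residue class $\{2^{i}q+r: q\in\mathbb{N}\}$ with $0\le r<2^i$; the root (level 0) is all of $\mathbb{N}$. A node is terminating if $\nu_2(f(n))$ is constant on its class (this constant is the valuation of the node), and non-terminating otherwise. Each non-terminating node $\{2^iq+r\}$ has two children at level $i+1$, namely $\{2^{i+1}q+r\}$ and $\{2^{i+1}q+2^i+r\}$; terminating nodes have no children. An infinite branch is an infinite sequence of nodes, one at each level $i\geq 0$, each a child of the previous one. -}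

module Defs where

open import Data.Nat using (ℕ; zero; suc; _+_; _*_; _^_)
open import Data.Integer as ℤ using (ℤ; +_)
open import Data.Integer.Divisibility using (_∣_)
open import Data.Product using (_×_)
open import Data.Sum using (_⊎_)
open import Function.Bundles using (_⇔_)
open import Relation.Nullary using (¬_)
open import Relation.Binary.PropositionalEquality using (_≡_)

quad : ℤ → ℤ → ℤ → ℕ → ℤ
quad a b c n = a ℤ.* (+ n ℤ.* + n) ℤ.+ b ℤ.* (+ n) ℤ.+ c

ν₂Is : ℤ → ℕ → Set
ν₂Is x k = ((+ (2 ^ k)) ∣ x) × ¬ ((+ (2 ^ suc k)) ∣ x)

-- ν₂(x) = ν₂(y) in ℕ ∪ {∞}: x and y are divisible by exactly the same powers of 2
ν₂Eq : ℤ → ℤ → Set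
ν₂Eq x y = ∀ k → ((+ (2 ^ k)) ∣ x) ⇔ ((+ (2 ^ k)) ∣ y)

-- the node {2^i q + r : q ∈ ℕ} at level i
-- terminating: ν₂(f(·)) constant on the class
Terminating : (ℕ → ℤ) → ℕ → ℕ → Set
Terminating f i r = ∀ q q′ → ν₂Eq (f (2 ^ i * q + r)) (f (2 ^ i * q′ + r))

NonTerminating : (ℕ → ℤ) → ℕ → ℕ → Set
NonTerminating f i r = ¬ Terminating f i r

data InTree (f : ℕ → ℤ) : ℕ → ℕ → Set where
  root  : InTree f 0 0
  left  : ∀ {i r} → InTree f i r → NonTerminating f i r → InTree f (suc i) r
  right : ∀ {i r} → InTree f i r → NonTerminating f i r → InTree f (suc i) (2 ^ i + r)

NodeValuation : (ℕ → ℤ) → ℕ → ℕ → ℕ → Set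
NodeValuation f i r v = ∀ q → ν₂Is (f (2 ^ i * q + r)) v

-- an infinite branch, given by the residues β i of its node at each level i:
-- starts at the root and each node is a child of the previous one
-- (so in particular the previous node is non-terminating)
InfiniteBranch : (ℕ → ℤ) → (ℕ → ℕ) → Set
InfiniteBranch f β =
  (β 0 ≡ 0) ×
  (∀ i → NonTerminating f i (β i) × ((β (suc i) ≡ β i) ⊎ (β (suc i) ≡ 2 ^ i + β i)))

{-# OPTIONS --safe #-}
-- Since a is even and b is odd, f(m + r) − f(r) = m · (a (m + 2r) + b) is m times an odd
-- number, so 2^i ∣ f(x) − f(y) iff 2^i ∣ x − y.  Hence f has exactly one root modulo 2^i
-- below 2^i, and a node of level i is non-terminating iff its residue is that root: if
-- 2^i ∤ f(r), adding multiples of 2^i does not change ν₂(f(r)) < i, while if 2^i ∣ f(r) then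
-- exactly one of f(r) and f(2^i + r) is divisible by 2^(i+1).  The roots form the unique
-- infinite branch, and the root's other child at level i + 1 is the terminating node, of
-- valuation exactly i.
module Submission where

open import Defs
open import Data.Nat using (ℕ; _≤_; _∸_)
open import Data.Integer using (ℤ; 0ℤ; +_)
open import Data.Integer.Divisibility using (_∣_)
open import Data.Product using (Σ; _×_)
open import Relation.Nullary using (¬_)
open import Relation.Binary.PropositionalEquality using (_≡_)

open import Data.Nat using (zero; suc; _+_; _*_; _^_; _<_; s≤s; z≤n)
open import Data.Nat.Properties
  using (≤-total; <-≤-trans; ≤-<-trans; m≤m+n; m≤n+m; +-monoʳ-<; +-comm; +-identityʳ;
         *-comm; *-assoc; *-zeroʳ; *-identityʳ; ^-distribˡ-+-*; m^n≢0; m≤n⇒∃[o]m+o≡n)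
import Data.Nat.Divisibility as ℕ
open import Data.Nat.Primality using (euclidsLemma; prime[2])
import Data.Integer as ℤ
import Data.Integer.Properties as ℤₚ
open import Data.Integer.DivMod using (_%_; _/_; n%d<d; a≡a%n+[a/n]*n)
open import Data.Integer.Divisibility.Signed
  using (divides; ∣ᵤ⇒∣; ∣⇒∣ᵤ; _∣?_; ∣-refl; ∣-trans; ∣m∣n⇒∣m+n; ∣m+n∣m⇒∣n; ∣m+n∣n⇒∣m;
         ∣m⇒∣m*n; *-monoˡ-∣; *-cancelʳ-∣)
  renaming (_∣_ to _∣ₛ_)
open import Data.Integer.Tactic.RingSolver using (solve-∀)
open import Data.Product using (∃; _,_; proj₁; proj₂)
open import Data.Sum using (_⊎_; inj₁; inj₂)
open import Function.Base using (_∘_)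
open import Function.Bundles using (mk⇔; Equivalence)
import Function.Properties.Equivalence as ⇔
open import Relation.Nullary using (Dec; contradiction; yes; no)
open import Relation.Nullary.Decidable using (decidable-stable; map′)
open import Relation.Binary.PropositionalEquality using (refl; sym; trans; cong; subst)

infix 8 2^_

2^_ : ℕ → ℤ
2^ k = + (2 ^ k)

2^-mono-∣ : ∀ {k i} → k ≤ i → 2^ k ∣ₛ 2^ i
2^-mono-∣ {k} k≤i with m≤n⇒∃[o]m+o≡n k≤i
... | o , refl = ∣ᵤ⇒∣ (subst (2 ^ k ℕ.∣_) (sym (^-distribˡ-+-* 2 k o)) (ℕ.m∣m*n (2 ^ o)))

2^∣2^* : ∀ i q → 2^ i ∣ₛ + (2 ^ i * q)
2^∣2^* i q = divides (+ q) (trans (ℤₚ.pos-* (2 ^ i) q) (ℤₚ.*-comm (2^ i) (+ q)))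

2^-suc : ∀ i → 2^ suc i ≡ + 2 ℤ.* 2^ i
2^-suc i = ℤₚ.pos-* 2 (2 ^ i)

2^-suc-∣-*2^⇒2∣ : ∀ i t → 2^ suc i ∣ₛ t ℤ.* 2^ i → + 2 ∣ₛ t
2^-suc-∣-*2^⇒2∣ i t d =
  *-cancelʳ-∣ (2^ i) {{m^n≢0 2 i}} (subst (_∣ₛ t ℤ.* 2^ i) (2^-suc i) d)

2∣⇒2^-suc-∣-*2^ : ∀ i t → + 2 ∣ₛ t → 2^ suc i ∣ₛ t ℤ.* 2^ i
2∣⇒2^-suc-∣-*2^ i t d = subst (_∣ₛ t ℤ.* 2^ i) (sym (2^-suc i)) (*-monoˡ-∣ (2^ i) d)

2^∣*odd⇒2^∣ : ∀ i m w → 2 ^ i ℕ.∣ m * w → ¬ (2 ℕ.∣ w) → 2 ^ i ℕ.∣ m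
2^∣*odd⇒2^∣ zero m w _ _ = ℕ.1∣ m
2^∣*odd⇒2^∣ (suc i) m w d 2∤w with euclidsLemma m w prime[2] (ℕ.∣-trans (ℕ.m∣m*n (2 ^ i)) d)
... | inj₂ 2∣w = contradiction 2∣w 2∤w
... | inj₁ (ℕ.divides m′ refl) =
  subst (2 ^ suc i ℕ.∣_) (*-comm 2 m′) (ℕ.*-monoʳ-∣ 2 (2^∣*odd⇒2^∣ i m′ w 2^i∣m′*w 2∤w))
  where
  2^i∣m′*w : 2 ^ i ℕ.∣ m′ * w
  2^i∣m′*w = ℕ.*-cancelˡ-∣ 2
    (subst (2 ^ suc i ℕ.∣_) (trans (cong (_* w) (*-comm m′ 2)) (*-assoc 2 m′ w)) d)

∣∧<⇒≡0 : ∀ {n m} → n ℕ.∣ m → m < n → m ≡ 0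
∣∧<⇒≡0 {m = zero} _ _ = refl
∣∧<⇒≡0 {m = suc _} n∣m m<n = contradiction n∣m (ℕ.>⇒∤ m<n)

odd⇒≡1+k*2 : ∀ {s} → ¬ (+ 2 ∣ₛ s) → ∃ λ k → s ≡ + 1 ℤ.+ k ℤ.* + 2
odd⇒≡1+k*2 {s} 2∤s with s % + 2 | n%d<d s (+ 2) | a≡a%n+[a/n]*n s (+ 2)
... | 0 | _ | s≡ = contradiction (divides (s / + 2) (trans s≡ (ℤₚ.+-identityˡ _))) 2∤s
... | 1 | _ | s≡ = s / + 2 , s≡
... | suc (suc _) | s≤s (s≤s ()) | _

odd+odd⇒even : ∀ {s u} → ¬ (+ 2 ∣ₛ s) → ¬ (+ 2 ∣ₛ u) → + 2 ∣ₛ s ℤ.+ u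
odd+odd⇒even 2∤s 2∤u with odd⇒≡1+k*2 2∤s | odd⇒≡1+k*2 2∤u
... | k , refl | l , refl = divides (+ 1 ℤ.+ k ℤ.+ l) (sum k l)
  where
  sum : ∀ k l → (+ 1 ℤ.+ k ℤ.* + 2) ℤ.+ (+ 1 ℤ.+ l ℤ.* + 2) ≡ (+ 1 ℤ.+ k ℤ.+ l) ℤ.* + 2
  sum = solve-∀

-- Below level i the summand z is invisible; from level i on neither side is divisible.
ν₂Eq-+ʳ : ∀ {i y z} → ¬ (2^ i ∣ₛ y) → 2^ i ∣ₛ z → ν₂Eq (y ℤ.+ z) y
ν₂Eq-+ʳ {i} {y} {z} 2^i∤y 2^i∣z k with ≤-total k i
... | inj₁ k≤i = mk⇔ (λ h → ∣⇒∣ᵤ (∣m+n∣n⇒∣m {m = y} (∣ᵤ⇒∣ h) 2^k∣z))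
                     (λ h → ∣⇒∣ᵤ (∣m∣n⇒∣m+n {m = y} (∣ᵤ⇒∣ h) 2^k∣z))
  where
  2^k∣z : 2^ k ∣ₛ z
  2^k∣z = ∣-trans (2^-mono-∣ k≤i) 2^i∣z
... | inj₂ i≤k = mk⇔ (λ h → contradiction (∣-trans 2^i∣2^k (∣ᵤ⇒∣ h)) 2^i∤y+z)
                     (λ h → contradiction (∣-trans 2^i∣2^k (∣ᵤ⇒∣ h)) 2^i∤y)
  where
  2^i∣2^k : 2^ i ∣ₛ 2^ k
  2^i∣2^k = 2^-mono-∣ i≤k
  2^i∤y+z : ¬ (2^ i ∣ₛ y ℤ.+ z)
  2^i∤y+z 2^i∣y+z = 2^i∤y (∣m+n∣n⇒∣m 2^i∣y+z 2^i∣z)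

ν₂Is-resp-ν₂Eq : ∀ {x y v} → ν₂Eq x y → ν₂Is y v → ν₂Is x v
ν₂Is-resp-ν₂Eq {v = v} x≈y (2^v∣y , 2^v+1∤y) =
  Equivalence.from (x≈y v) 2^v∣y , 2^v+1∤y ∘ Equivalence.to (x≈y (suc v))

Child : ℕ → ℕ → ℕ → Set
Child i r r′ = (r′ ≡ r) ⊎ (r′ ≡ 2 ^ i + r)

child-< : ∀ {i r r′} → r < 2 ^ i → Child i r r′ → r′ < 2 ^ suc i
child-< {i} r< (inj₁ refl) = <-≤-trans r< (m≤m+n (2 ^ i) _)
child-< {i} r< (inj₂ refl) = +-monoʳ-< (2 ^ i) (<-≤-trans r< (m≤m+n (2 ^ i) 0))

child-∈-class : ∀ {i r r′} → Child i r r′ → ∃ λ q → r′ ≡ 2 ^ i * q + r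
child-∈-class {i} {r} (inj₁ refl) = 0 , cong (_+ r) (sym (*-zeroʳ (2 ^ i)))
child-∈-class {i} {r} (inj₂ refl) = 1 , cong (_+ r) (sym (*-identityʳ (2 ^ i)))

module Nodes (f : ℕ → ℤ) where

  terminating-children : ∀ {i r s s′} → Terminating f i r → Child i r s → Child i r s′ →
    ν₂Eq (f s) (f s′)
  terminating-children {i} term s-child s′-child
    with child-∈-class {i} s-child | child-∈-class {i} s′-child
  ... | q , refl | q′ , refl = term q q′

  inTree-child : ∀ {i r r′} → InTree f i r → NonTerminating f i r → Child i r r′ → InTree f (suc i) r′
  inTree-child t nt (inj₁ refl) = left t nt
  inTree-child t nt (inj₂ refl) = right t nt

  inTree-parent : ∀ {i r′} → InTree f (suc i) r′ →
    ∃ λ r → InTree f i r × NonTerminating f i r × Child i r r′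
  inTree-parent (left t nt) = _ , t , nt , inj₁ refl
  inTree-parent (right t nt) = _ , t , nt , inj₂ refl

  inTree-< : ∀ {i r} → InTree f i r → r < 2 ^ i
  inTree-< root = s≤s z≤n
  inTree-< (left {i} t _) = child-< {i} (inTree-< t) (inj₁ refl)
  inTree-< (right {i} t _) = child-< {i} (inTree-< t) (inj₂ refl)

  infiniteBranch-< : ∀ {β} → InfiniteBranch f β → ∀ i → β i < 2 ^ i
  infiniteBranch-< (β0≡0 , _) zero rewrite β0≡0 = s≤s z≤n
  infiniteBranch-< b@(_ , steps) (suc i) = child-< {i} (infiniteBranch-< b i) (proj₂ (steps i))

module ValuationTree
  (g : ℕ → ℤ) (δ : ℕ → ℕ → ℤ)
  (δ-odd : ∀ m r → ¬ (+ 2 ∣ₛ δ m r))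
  (g-+ : ∀ m r → g (m + r) ≡ g r ℤ.+ + m ℤ.* δ m r)
  where

  open Nodes g

  record Root (i r : ℕ) : Set where
    constructor root-by
    field divisibility : 2^ i ∣ₛ g r

  open Root

  root? : ∀ i r → Dec (Root i r)
  root? i r = map′ root-by divisibility (2^ i ∣? g r)

  ν₂Eq-class : ∀ {i r} → ¬ Root i r → ∀ q → ν₂Eq (g (2 ^ i * q + r)) (g r)
  ν₂Eq-class {i} {r} ¬root q rewrite g-+ (2 ^ i * q) r =
    ν₂Eq-+ʳ {i} {g r} (¬root ∘ root-by) (∣m⇒∣m*n (δ (2 ^ i * q) r) (2^∣2^* i q))

  ¬root⇒terminating : ∀ {i r} → ¬ Root i r → Terminating g i r
  ¬root⇒terminating ¬root q q′ k =
    ⇔.trans (ν₂Eq-class ¬root q k) (⇔.sym (ν₂Eq-class ¬root q′ k))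

  root-child-root : ∀ {i r s} → Root i r → Child i r s → Root i s
  root-child-root r-root (inj₁ refl) = r-root
  root-child-root {i} {r} (root-by 2^i∣g-r) (inj₂ refl) =
    root-by (subst (2^ i ∣ₛ_) (sym (g-+ (2 ^ i) r))
                   (∣m∣n⇒∣m+n 2^i∣g-r (∣m⇒∣m*n (δ (2 ^ i) r) ∣-refl)))

  sibling-quotient : ∀ {i r u} → g r ≡ u ℤ.* 2^ i →
    g (2 ^ i + r) ≡ (u ℤ.+ δ (2 ^ i) r) ℤ.* 2^ i
  sibling-quotient {i} {r} {u} g-r≡ rewrite g-+ (2 ^ i) r | g-r≡ = shift u (2^ i) (δ (2 ^ i) r)
    where
    shift : ∀ u p d → u ℤ.* p ℤ.+ p ℤ.* d ≡ (u ℤ.+ d) ℤ.* p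
    shift = solve-∀

  root-children-not-both-root : ∀ {i r} → Root i r → Root (suc i) r → ¬ Root (suc i) (2 ^ i + r)
  root-children-not-both-root {i} {r} (root-by (divides u g-r≡)) (root-by 2^i+1∣g-r)
                              (root-by 2^i+1∣g-sibling) =
    δ-odd (2 ^ i) r (∣m+n∣m⇒∣n 2∣u+δ 2∣u)
    where
    2∣u : + 2 ∣ₛ u
    2∣u = 2^-suc-∣-*2^⇒2∣ i u (subst (2^ suc i ∣ₛ_) g-r≡ 2^i+1∣g-r)
    2∣u+δ : + 2 ∣ₛ u ℤ.+ δ (2 ^ i) r
    2∣u+δ = 2^-suc-∣-*2^⇒2∣ i (u ℤ.+ δ (2 ^ i) r)
      (subst (2^ suc i ∣ₛ_) (sibling-quotient {i} {r} {u} g-r≡) 2^i+1∣g-sibling)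

  root-children-some-root : ∀ {i r} → Root i r → ¬ Root (suc i) r → Root (suc i) (2 ^ i + r)
  root-children-some-root {i} {r} (root-by (divides u g-r≡)) ¬r-root′ =
    root-by (subst (2^ suc i ∣ₛ_) (sym (sibling-quotient {i} {r} {u} g-r≡))
                   (2∣⇒2^-suc-∣-*2^ i (u ℤ.+ δ (2 ^ i) r) (odd+odd⇒even 2∤u (δ-odd (2 ^ i) r))))
    where
    2∤u : ¬ (+ 2 ∣ₛ u)
    2∤u 2∣u = ¬r-root′ (root-by (subst (2^ suc i ∣ₛ_) (sym g-r≡) (2∣⇒2^-suc-∣-*2^ i u 2∣u)))

  root-child : ∀ {i r} → Root i r → ∃ λ r′ → Child i r r′ × Root (suc i) r′
  root-child {i} {r} r-root with root? (suc i) r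
  ... | yes r-root′ = r , inj₁ refl , r-root′
  ... | no ¬r-root′ = 2 ^ i + r , inj₂ refl , root-children-some-root r-root ¬r-root′

  nonroot-child : ∀ {i r} → Root i r → ∃ λ s → Child i r s × ¬ Root (suc i) s
  nonroot-child {i} {r} r-root with root? (suc i) r
  ... | yes r-root′ = 2 ^ i + r , inj₂ refl , root-children-not-both-root r-root r-root′
  ... | no ¬r-root′ = r , inj₁ refl , ¬r-root′

  nonroot-child-unique : ∀ {i r s s′} → Root i r → Child i r s → Child i r s′ →
    ¬ Root (suc i) s → ¬ Root (suc i) s′ → s ≡ s′
  nonroot-child-unique _ (inj₁ refl) (inj₁ refl) _ _ = refl
  nonroot-child-unique _ (inj₂ refl) (inj₂ refl) _ _ = refl
  nonroot-child-unique r-root (inj₁ refl) (inj₂ refl) ¬s-root ¬s′-root =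
    contradiction (root-children-some-root r-root ¬s-root) ¬s′-root
  nonroot-child-unique r-root (inj₂ refl) (inj₁ refl) ¬s-root ¬s′-root =
    contradiction (root-children-some-root r-root ¬s′-root) ¬s-root

  root⇒nonTerminating : ∀ {i r} → Root i r → NonTerminating g i r
  root⇒nonTerminating {i} r-root term with root-child r-root | nonroot-child r-root
  ... | s , s-child , root-by 2^i+1∣g-s | s′ , s′-child , ¬s′-root = ¬s′-root (root-by (∣ᵤ⇒∣ 2^i+1∣g-s′))
    where
    2^i+1∣g-s′ : 2^ suc i ∣ g s′
    2^i+1∣g-s′ = Equivalence.to (terminating-children {i} term s-child s′-child (suc i)) (∣⇒∣ᵤ 2^i+1∣g-s)

  nonTerminating⇒root : ∀ {i r} → NonTerminating g i r → Root i r
  nonTerminating⇒root {i} {r} nt = decidable-stable (root? i r) (nt ∘ ¬root⇒terminating)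

  root-increment : ∀ {i r m} → Root i r → Root i (m + r) → 2 ^ i ℕ.∣ m
  root-increment {i} {r} {m} (root-by 2^i∣g-r) (root-by 2^i∣g-m+r) =
    2^∣*odd⇒2^∣ i m _ (subst (2 ^ i ℕ.∣_) (ℤₚ.abs-* (+ m) (δ m r)) (∣⇒∣ᵤ 2^i∣m*δ))
                      (δ-odd m r ∘ ∣ᵤ⇒∣)
    where
    2^i∣m*δ : 2^ i ∣ₛ + m ℤ.* δ m r
    2^i∣m*δ = ∣m+n∣m⇒∣n (subst (2^ i ∣ₛ_) (g-+ m r) 2^i∣g-m+r) 2^i∣g-r

  roots-unique-≤ : ∀ {i x y} → x ≤ y → y < 2 ^ i → Root i x → Root i y → x ≡ y
  roots-unique-≤ {i} {x} x≤y y< x-root y-root with m≤n⇒∃[o]m+o≡n x≤y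
  ... | m , refl = sym (trans (cong (_+_ x) m≡0) (+-identityʳ x))
    where
    m≡0 : m ≡ 0
    m≡0 = ∣∧<⇒≡0 (root-increment x-root (subst (Root i) (+-comm x m) y-root))
                 (≤-<-trans (m≤n+m m x) y<)

  roots-unique : ∀ {i x y} → x < 2 ^ i → y < 2 ^ i → Root i x → Root i y → x ≡ y
  roots-unique {x = x} {y} x< y< x-root y-root with ≤-total x y
  ... | inj₁ x≤y = roots-unique-≤ x≤y y< x-root y-root
  ... | inj₂ y≤x = sym (roots-unique-≤ y≤x x< y-root x-root)

  rootAt : (i : ℕ) → ∃ (Root i)
  rootAt zero = 0 , root-by (∣ᵤ⇒∣ (ℕ.1∣ _))
  rootAt (suc i) = proj₁ next , proj₂ (proj₂ next)
    where
    next : ∃ λ r′ → Child i (proj₁ (rootAt i)) r′ × Root (suc i) r′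
    next = root-child (proj₂ (rootAt i))

  β : ℕ → ℕ
  β i = proj₁ (rootAt i)

  β-root : ∀ i → Root i (β i)
  β-root i = proj₂ (rootAt i)

  β-child : ∀ i → Child i (β i) (β (suc i))
  β-child i = proj₁ (proj₂ (root-child (β-root i)))

  β-infiniteBranch : InfiniteBranch g β
  β-infiniteBranch = refl , λ i → root⇒nonTerminating (β-root i) , β-child i

  infiniteBranch-unique : ∀ β β′ → InfiniteBranch g β → InfiniteBranch g β′ → ∀ i → β i ≡ β′ i
  infiniteBranch-unique β β′ b b′ i =
    roots-unique {i} (infiniteBranch-< b i) (infiniteBranch-< b′ i)
                     (nonTerminating⇒root (proj₁ (proj₂ b i))) (nonTerminating⇒root (proj₁ (proj₂ b′ i)))

  β-inTree : ∀ i → InTree g i (β i)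
  β-inTree zero = root
  β-inTree (suc i) = inTree-child (β-inTree i) (root⇒nonTerminating (β-root i)) (β-child i)

  inTree-nonTerminating⇒β : ∀ {i r} → InTree g i r → NonTerminating g i r → r ≡ β i
  inTree-nonTerminating⇒β {i} t nt =
    roots-unique {i} (inTree-< t) (infiniteBranch-< β-infiniteBranch i)
                     (nonTerminating⇒root nt) (β-root i)

  terminatingNode : ∀ i → 1 ≤ i → Σ ℕ λ s →
    InTree g i s × Terminating g i s
    × (∀ s′ → InTree g i s′ → Terminating g i s′ → s′ ≡ s)
    × NodeValuation g i s (i ∸ 1)
  terminatingNode (suc j) _ =
    s , inTree-child (β-inTree j) (root⇒nonTerminating (β-root j)) s-child ,
    ¬root⇒terminating ¬s-root , unique , valuation
    where
    s : ℕ
    s = proj₁ (nonroot-child (β-root j))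
    s-child : Child j (β j) s
    s-child = proj₁ (proj₂ (nonroot-child (β-root j)))
    ¬s-root : ¬ Root (suc j) s
    ¬s-root = proj₂ (proj₂ (nonroot-child (β-root j)))

    unique : ∀ s′ → InTree g (suc j) s′ → Terminating g (suc j) s′ → s′ ≡ s
    unique s′ t term with inTree-parent t
    ... | r , r-inTree , r-nt , s′-child rewrite inTree-nonTerminating⇒β r-inTree r-nt =
      nonroot-child-unique (β-root j) s′-child s-child
        (λ s′-root → root⇒nonTerminating s′-root term) ¬s-root

    valuation : NodeValuation g (suc j) s j
    valuation q = ν₂Is-resp-ν₂Eq {g (2 ^ suc j * q + s)} {g s} {j} (ν₂Eq-class ¬s-root q)
                    (∣⇒∣ᵤ (divisibility (root-child-root (β-root j) s-child)) , ¬s-root ∘ root-by ∘ ∣ᵤ⇒∣)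

quadIncrement : ℤ → ℤ → ℕ → ℕ → ℤ
quadIncrement a b m r = a ℤ.* (+ m ℤ.+ + r ℤ.+ + r) ℤ.+ b

quad-+ : ∀ a b c m r → quad a b c (m + r) ≡ quad a b c r ℤ.+ + m ℤ.* quadIncrement a b m r
quad-+ a b c m r =
  trans (cong (λ x → a ℤ.* (x ℤ.* x) ℤ.+ b ℤ.* x ℤ.+ c) (ℤₚ.pos-+ m r)) (expand a b c (+ m) (+ r))
  where
  expand : ∀ a b c m r → a ℤ.* ((m ℤ.+ r) ℤ.* (m ℤ.+ r)) ℤ.+ b ℤ.* (m ℤ.+ r) ℤ.+ c
    ≡ (a ℤ.* (r ℤ.* r) ℤ.+ b ℤ.* r ℤ.+ c) ℤ.+ m ℤ.* (a ℤ.* (m ℤ.+ r ℤ.+ r) ℤ.+ b)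
  expand = solve-∀

quadIncrement-odd : ∀ a b → + 2 ∣ a → ¬ (+ 2 ∣ b) → ∀ m r → ¬ (+ 2 ∣ₛ quadIncrement a b m r)
quadIncrement-odd a b 2∣a 2∤b m r 2∣δ =
  2∤b (∣⇒∣ᵤ (∣m+n∣m⇒∣n 2∣δ (∣m⇒∣m*n (+ m ℤ.+ + r ℤ.+ + r) (∣ᵤ⇒∣ {+ 2} {a} 2∣a))))

proposition7 : (a b c : ℤ) → ¬ (a ≡ 0ℤ) → (+ 2) ∣ a → ¬ ((+ 2) ∣ b) →
    (Σ (ℕ → ℕ) (InfiniteBranch (quad a b c))
      × (∀ β β′ → InfiniteBranch (quad a b c) β → InfiniteBranch (quad a b c) β′ → ∀ i → β i ≡ β′ i))
    × (∀ i → 1 ≤ i → Σ ℕ λ r →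
        InTree (quad a b c) i r × Terminating (quad a b c) i r
        × (∀ r′ → InTree (quad a b c) i r′ → Terminating (quad a b c) i r′ → r′ ≡ r)
        × NodeValuation (quad a b c) i r (i ∸ 1))
proposition7 a b c _ 2∣a 2∤b = ((β , β-infiniteBranch) , infiniteBranch-unique) , terminatingNode
  where
  open ValuationTree (quad a b c) (quadIncrement a b) (quadIncrement-odd a b 2∣a 2∤b) (quad-+ a b c)
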